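{- There exist positive integers $n$ and $k$ such that every family of functions $f_1^{n,k},\dots,f_n^{n,k}$ that is a valid dynamic task allocation for $n$ agents and $k$ tasks has maximum switching cost at least $4$.
   Context: There are $n$ agents and $k$ tasks. A demand vector is $\vec v=(v_1,\dots,v_k)$ with each $v_i$ a non-negative integer and $\sum_i v_i=n$. A valid allocation is a family of deterministic functions $f_1^{n,k},\dots,f_n^{n,k}$, one per agent, each mapping demand vectors to $[k]$, such that for every demand vector $\vec v$ and every task $i$, the number of agents $a$ with $f_a^{n,k}(\vec v)=i$ is exactly $v_i$. Two demand vectors are adjacent if their $\ell_1$ distance is $2$. The switching cost of a pair $(\vec v,\vec v')$ is the number of agents $a$ with $f_a^{n,k}(\vec v)\neq f_a^{n,k}(\vec v')$; the maximum switching cost of the family is the maximum of this over all adjacent pairs. -}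

module Defs where

open import Data.Nat using (ℕ; zero; suc; _+_; _≥_)
open import Data.Nat using (∣_-_∣)
open import Data.Fin using (Fin; zero; suc; _≟_)
open import Data.Product using (Σ; ∃; _×_; _,_; proj₁)
open import Relation.Binary.PropositionalEquality using (_≡_)
open import Relation.Nullary using (Dec; yes; no; ¬_)
open import Relation.Nullary.Decidable using (¬?)

∑ : ∀ {m} → (Fin m → ℕ) → ℕ
∑ {zero}  f = 0
∑ {suc m} f = f zero + ∑ (λ i → f (suc i))

count : ∀ {m} {P : Fin m → Set} → ((i : Fin m) → Dec (P i)) → ℕ
count {zero}  d = 0
count {suc m} d with d zero
... | yes _ = suc (count (λ i → d (suc i)))
... | no  _ = count (λ i → d (suc i))

DemandVector : ℕ → ℕ → Set
DemandVector n k = Σ (Fin k → ℕ) (λ v → ∑ v ≡ n)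

Family : ℕ → ℕ → Set
Family n k = Fin n → DemandVector n k → Fin k

ValidAllocation : ∀ {n k} → Family n k → Set
ValidAllocation {n} {k} f =
  (v : DemandVector n k) (i : Fin k) →
    count (λ (a : Fin n) → f a v ≟ i) ≡ proj₁ v i

ℓ₁ : ∀ {n k} → DemandVector n k → DemandVector n k → ℕ
ℓ₁ (v , _) (w , _) = ∑ (λ i → ∣ v i - w i ∣)

Adjacent : ∀ {n k} → DemandVector n k → DemandVector n k → Set
Adjacent v w = ℓ₁ v w ≡ 2

switchingCost : ∀ {n k} → Family n k → DemandVector n k → DemandVector n k → ℕ
switchingCost {n} f v w = count (λ (a : Fin n) → ¬? (f a v ≟ f a w))

MaxSwitchingCostAtLeast : ∀ {n k} → Family n k → ℕ → Set
MaxSwitchingCostAtLeast {n} {k} f c =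
  Σ (DemandVector n k) λ v → Σ (DemandVector n k) λ w →
    Adjacent v w × switchingCost f v w ≥ c

-- Take n agents and demand vectors that put one unit on each of n tasks x₁ < ⋯ < xₙ.
-- Colour the tuple (x₁, …, xₙ) by recording, for every agent, the position i of its
-- task x_i.  A shift-graph version of Ramsey's theorem gives, for k large enough,
-- x₁ < ⋯ < xₙ₊₁ such that (x₁, …, xₙ) and (x₂, …, xₙ₊₁) get the same colour.  The two
-- demand vectors are adjacent (they differ by moving one unit from x₁ to xₙ₊₁), yet an
-- agent at position i moves from x_i to x_{i+1}, so all n agents switch.
module Submission where

open import Defs
open import Data.Nat as ℕ using (ℕ; zero; suc; _+_; _^_; _≥_; _≤_; z≤n; s≤s; ∣_-_∣)
open import Data.Nat.Properties
  using (+-comm; +-assoc; +-commutativeSemigroup; ≤-reflexive; n<1+n; ∣m+n-m+o∣≡∣n-o∣; ∣-∣-identityˡ)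
open import Algebra.Properties.CommutativeSemigroup +-commutativeSemigroup
  using () renaming (interchange to +-interchange)
open import Data.Fin using (Fin; zero; suc; _<_; _≟_; funToFin; finToFun)
open import Data.Fin.Properties using (pigeonhole; any?; _<?_; <⇒≢; <-trans; finToFun-funToFin)
open import Data.Vec using (Vec; []; _∷_; _∷ʳ_; lookup; last)
open import Data.Vec.Relation.Unary.Any using (here; there; index)
import Data.Vec.Relation.Unary.Any as Any
open import Data.Vec.Relation.Unary.Any.Properties using (lookup-index)
open import Data.Vec.Relation.Unary.Linked using (Linked; [-]; _∷_)
open import Data.Vec.Membership.Propositional using (_∈_)
open import Data.Product using (Σ; Σ-syntax; _×_; _,_; proj₁)
open import Data.Empty using (⊥-elim)
open import Function using (_∘_)
open import Relation.Binary.Core using (Rel)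
open import Relation.Binary.Definitions using (Transitive)
open import Relation.Binary.PropositionalEquality
  using (_≡_; _≢_; refl; sym; trans; cong; cong₂; subst; subst₂; module ≡-Reasoning)
open import Relation.Nullary using (Dec; yes; no)
open import Relation.Nullary.Decidable using (_×-dec_; ¬?)


funToFin-injective : ∀ {m n} (F G : Fin m → Fin n) → funToFin F ≡ funToFin G → ∀ i → F i ≡ G i
funToFin-injective F G eq i = begin
  F i                      ≡⟨ sym (finToFun-funToFin F i) ⟩
  finToFun (funToFin F) i  ≡⟨ cong (λ u → finToFun u i) eq ⟩
  finToFun (funToFin G) i  ≡⟨ finToFun-funToFin G i ⟩
  G i                      ∎
  where open ≡-Reasoning

indicator : ∀ {p} {P : Set p} → Dec P → Fin 2
indicator (yes _) = suc zero
indicator (no _)  = zero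

indicator-transfer : ∀ {p q} {P : Set p} {Q : Set q} (P? : Dec P) (Q? : Dec Q) →
  indicator P? ≡ indicator Q? → P → Q
indicator-transfer _        (yes q) _  _ = q
indicator-transfer (yes _)  (no _)  () _
indicator-transfer (no ¬p)  (no _)  _  p = ⊥-elim (¬p p)

module _ {a ℓ} {A : Set a} {R : Rel A ℓ} where

  Linked-∷ʳ⁺ : ∀ {n} {xs : Vec A (suc n)} {y} → Linked R xs → R (last xs) y → Linked R (xs ∷ʳ y)
  Linked-∷ʳ⁺ {xs = _ ∷ []}    [-]      Rxy = Rxy ∷ [-]
  Linked-∷ʳ⁺ {xs = _ ∷ _ ∷ _} (Rxx ∷ l) Rly = Rxx ∷ Linked-∷ʳ⁺ l Rly

  Linked-∷ʳ⁻ : ∀ {n} (xs : Vec A (suc n)) {y} → Linked R (xs ∷ʳ y) → R (last xs) y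
  Linked-∷ʳ⁻ (_ ∷ [])     (Rxy ∷ _) = Rxy
  Linked-∷ʳ⁻ (_ ∷ x ∷ xs) (_ ∷ l)   = Linked-∷ʳ⁻ (x ∷ xs) l

  Linked-ends : Transitive R → ∀ {n x y} (mid : Vec A n) → Linked R (x ∷ (mid ∷ʳ y)) → R x y
  Linked-ends _     []        (Rxy ∷ _) = Rxy
  Linked-ends trans (_ ∷ mid) (Rxm ∷ l) = trans Rxm (Linked-ends trans mid l)

  Linked-lookup-shift : ∀ {n x y} (mid : Vec A n) → Linked R (x ∷ (mid ∷ʳ y)) →
    ∀ j → R (lookup (x ∷ mid) j) (lookup (mid ∷ʳ y) j)
  Linked-lookup-shift []        (Rxy ∷ _) zero    = Rxy
  Linked-lookup-shift (_ ∷ _)   (Rxm ∷ _) zero    = Rxm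
  Linked-lookup-shift (_ ∷ mid) (_ ∷ l)   (suc j) = Linked-lookup-shift mid l j

tower : ℕ → ℕ → ℕ
tower zero    M = M
tower (suc r) M = tower r (2 ^ M)

-- The set of colours of c (xs ∷ʳ z) for z > last xs, encoded as a subset of Fin M.
extensions : ∀ {r M N} → (Vec (Fin N) (suc (suc r)) → Fin M) → Vec (Fin N) (suc r) → Fin (2 ^ M)
extensions c xs = funToFin λ i → indicator (any? λ z → (last xs <? z) ×-dec (c (xs ∷ʳ z) ≟ i))

shift-pigeonhole : ∀ r {M N} → tower r M ℕ.< N → (c : Vec (Fin N) (suc r) → Fin M) →
  Σ[ x ∈ Fin N ] Σ[ mid ∈ Vec (Fin N) r ] Σ[ y ∈ Fin N ]
    Linked _<_ (x ∷ (mid ∷ʳ y)) × c (x ∷ mid) ≡ c (mid ∷ʳ y)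
shift-pigeonhole zero bound c with pigeonhole bound (λ x → c (x ∷ []))
... | x , y , x<y , same = x , [] , y , x<y ∷ [-] , same
shift-pigeonhole (suc r) bound c with shift-pigeonhole r bound (extensions c)
... | x , mid , y , linked , same
  with z , y<z , same′ ← indicator-transfer _ _
         (funToFin-injective _ _ same (c (x ∷ (mid ∷ʳ y))))
         (y , Linked-∷ʳ⁻ (x ∷ mid) linked , refl)
  = x , mid ∷ʳ y , z , Linked-∷ʳ⁺ linked y<z , sym same′

∑-cong : ∀ {m} {f g : Fin m → ℕ} → (∀ i → f i ≡ g i) → ∑ f ≡ ∑ g
∑-cong {zero}  f≗g = refl
∑-cong {suc m} f≗g = cong₂ _+_ (f≗g zero) (∑-cong (f≗g ∘ suc))

∑-+ : ∀ {m} (f g : Fin m → ℕ) → ∑ (λ i → f i + g i) ≡ ∑ f + ∑ g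
∑-+ {zero}  f g = refl
∑-+ {suc m} f g =
  trans (cong (f zero + g zero +_) (∑-+ (f ∘ suc) (g ∘ suc)))
        (+-interchange (f zero) (g zero) (∑ (f ∘ suc)) (∑ (g ∘ suc)))

∑-zero : ∀ m → ∑ {m} (λ _ → 0) ≡ 0
∑-zero zero    = refl
∑-zero (suc m) = ∑-zero m

δ : ∀ {N} → Fin N → Fin N → ℕ
δ zero    zero    = 1
δ zero    (suc _) = 0
δ (suc _) zero    = 0
δ (suc x) (suc i) = δ x i

δ-refl : ∀ {N} (x : Fin N) → δ x x ≡ 1
δ-refl zero    = refl
δ-refl (suc x) = δ-refl x

δ-≢ : ∀ {N} {x i : Fin N} → x ≢ i → δ x i ≡ 0
δ-≢ {x = zero}  {zero}  x≢i = ⊥-elim (x≢i refl)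
δ-≢ {x = zero}  {suc _} _   = refl
δ-≢ {x = suc _} {zero}  _   = refl
δ-≢ {x = suc _} {suc _} x≢i = δ-≢ (x≢i ∘ cong suc)

∑-δ : ∀ {N} (x : Fin N) → ∑ (δ x) ≡ 1
∑-δ {suc N} zero    = cong suc (∑-zero N)
∑-δ {suc N} (suc x) = ∑-δ x

∣δ-δ∣ : ∀ {N} {x y : Fin N} → x ≢ y → ∀ i → ∣ δ x i - δ y i ∣ ≡ δ x i + δ y i
∣δ-δ∣ {x = x} {y} x≢y i with x ≟ i
... | yes refl rewrite δ-refl x | δ-≢ (x≢y ∘ sym) = refl
... | no x≢i   rewrite δ-≢ x≢i = ∣-∣-identityˡ (δ y i)

occupancy : ∀ {m N} → Vec (Fin N) m → Fin N → ℕ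
occupancy []       i = 0
occupancy (x ∷ xs) i = δ x i + occupancy xs i

∑-occupancy : ∀ {m N} (xs : Vec (Fin N) m) → ∑ (occupancy xs) ≡ m
∑-occupancy {N = N} [] = ∑-zero N
∑-occupancy (x ∷ xs) = trans (∑-+ (δ x) (occupancy xs)) (cong₂ _+_ (∑-δ x) (∑-occupancy xs))

occupancy-∷ʳ : ∀ {m N} (xs : Vec (Fin N) m) y i → occupancy (xs ∷ʳ y) i ≡ occupancy xs i + δ y i
occupancy-∷ʳ []       y i = +-comm (δ y i) 0
occupancy-∷ʳ (x ∷ xs) y i =
  trans (cong (δ x i +_) (occupancy-∷ʳ xs y i)) (sym (+-assoc (δ x i) (occupancy xs i) (δ y i)))

occupied⇒∈ : ∀ {m N} (xs : Vec (Fin N) m) {i} → 1 ≤ occupancy xs i → i ∈ xs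
occupied⇒∈ (x ∷ xs) {i} occupied with x ≟ i
... | yes refl = here refl
... | no x≢i   = there (occupied⇒∈ xs (subst (λ t → 1 ≤ t + occupancy xs i) (δ-≢ x≢i) occupied))

demand : ∀ {m N} → Vec (Fin N) m → DemandVector m N
demand xs = occupancy xs , ∑-occupancy xs

demand-adjacent : ∀ {m N} {x y : Fin N} (mid : Vec (Fin N) m) → x ≢ y →
  Adjacent (demand (x ∷ mid)) (demand (mid ∷ʳ y))
demand-adjacent {x = x} {y} mid x≢y = begin
  ∑ (λ i → ∣ δ x i + occupancy mid i - occupancy (mid ∷ʳ y) i ∣) ≡⟨ ∑-cong moved ⟩
  ∑ (λ i → δ x i + δ y i)                                         ≡⟨ ∑-+ (δ x) (δ y) ⟩
  ∑ (δ x) + ∑ (δ y)                                               ≡⟨ cong₂ _+_ (∑-δ x) (∑-δ y) ⟩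
  2                                                               ∎
  where
  open ≡-Reasoning
  moved : ∀ i → ∣ δ x i + occupancy mid i - occupancy (mid ∷ʳ y) i ∣ ≡ δ x i + δ y i
  moved i = begin
    ∣ δ x i + occupancy mid i - occupancy (mid ∷ʳ y) i ∣
      ≡⟨ cong₂ ∣_-_∣ (+-comm (δ x i) (occupancy mid i)) (occupancy-∷ʳ mid y i) ⟩
    ∣ occupancy mid i + δ x i - occupancy mid i + δ y i ∣
      ≡⟨ ∣m+n-m+o∣≡∣n-o∣ (occupancy mid i) (δ x i) (δ y i) ⟩
    ∣ δ x i - δ y i ∣
      ≡⟨ ∣δ-δ∣ x≢y i ⟩
    δ x i + δ y i ∎

count-all : ∀ {m} {P : Fin m → Set} (P? : ∀ i → Dec (P i)) → (∀ i → P i) → count P? ≡ m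
count-all {zero}  P? all = refl
count-all {suc m} P? all with P? zero
... | yes _  = cong suc (count-all (P? ∘ suc) (all ∘ suc))
... | no ¬p  = ⊥-elim (¬p (all zero))

count-pos : ∀ {m} {P : Fin m → Set} (P? : ∀ i → Dec (P i)) i → P i → 1 ≤ count P?
count-pos {suc m} P? i p with P? zero
... | yes _ = s≤s z≤n
count-pos {suc m} P? zero    p | no ¬p = ⊥-elim (¬p p)
count-pos {suc m} P? (suc i) p | no _  = count-pos (P? ∘ suc) i p

assigned-task-occupied : ∀ {n k} (f : Family n k) → ValidAllocation f →
  ∀ v a → 1 ≤ proj₁ v (f a v)
assigned-task-occupied f valid v a =
  subst (1 ≤_) (valid v (f a v)) (count-pos (λ b → f b v ≟ f a v) a refl)

position : ∀ {m N} (p : Fin N) (xs : Vec (Fin N) (suc m)) → Fin (suc m)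
position p xs with Any.any? (p ≟_) xs
... | yes p∈xs = index p∈xs
... | no  _    = zero

lookup-position : ∀ {m N} {p : Fin N} {xs : Vec (Fin N) (suc m)} → p ∈ xs → lookup xs (position p xs) ≡ p
lookup-position {p = p} {xs} p∈xs with Any.any? (p ≟_) xs
... | yes p∈xs′ = sym (lookup-index p∈xs′)
... | no  p∉xs  = ⊥-elim (p∉xs p∈xs)

positions : ∀ {r N} → Family (suc r) N → Vec (Fin N) (suc r) → Fin (suc r ^ suc r)
positions f xs = funToFin λ a → position (f a (demand xs)) xs

all-agents-switch : ∀ {r N} (f : Family (suc r) N) → ValidAllocation f →
  ∀ {x y} (mid : Vec (Fin N) r) → Linked _<_ (x ∷ (mid ∷ʳ y)) →
  positions f (x ∷ mid) ≡ positions f (mid ∷ʳ y) →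
  ∀ a → f a (demand (x ∷ mid)) ≢ f a (demand (mid ∷ʳ y))
all-agents-switch f valid {x} {y} mid linked same a = <⇒≢ (subst₂ _<_ before after shifted)
  where
  vA = demand (x ∷ mid)
  vB = demand (mid ∷ʳ y)
  j = position (f a vA) (x ∷ mid)
  before : lookup (x ∷ mid) j ≡ f a vA
  before = lookup-position (occupied⇒∈ (x ∷ mid) (assigned-task-occupied f valid vA a))
  after : lookup (mid ∷ʳ y) j ≡ f a vB
  after = trans (cong (lookup (mid ∷ʳ y)) (funToFin-injective (λ b → position (f b vA) (x ∷ mid))
                                                              (λ b → position (f b vB) (mid ∷ʳ y)) same a))
                (lookup-position (occupied⇒∈ (mid ∷ʳ y) (assigned-task-occupied f valid vB a)))
  shifted : lookup (x ∷ mid) j < lookup (mid ∷ʳ y) j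
  shifted = Linked-lookup-shift mid linked j

max-switching-cost-≥-agents : ∀ r {N} → tower r (suc r ^ suc r) ℕ.< N →
  (f : Family (suc r) N) → ValidAllocation f → MaxSwitchingCostAtLeast f (suc r)
max-switching-cost-≥-agents r bound f valid
  with x , mid , y , linked , same ← shift-pigeonhole r bound (positions f)
  = demand (x ∷ mid) , demand (mid ∷ʳ y)
  , demand-adjacent mid (<⇒≢ (Linked-ends <-trans mid linked))
  , ≤-reflexive (sym (count-all (λ a → ¬? (f a (demand (x ∷ mid)) ≟ f a (demand (mid ∷ʳ y))))
      (all-agents-switch f valid mid linked same)))

-- Opaque so that the type checker never tries to evaluate the tower of exponentials.
opaque
  colours : ℕ
  colours = 4 ^ 4

  colours-def : colours ≡ suc 3 ^ suc 3
  colours-def = refl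

theorem2 : Σ ℕ λ n → Σ ℕ λ k → n ≥ 1 × k ≥ 1 ×
    ((f : Family n k) → ValidAllocation f → MaxSwitchingCostAtLeast f 4)
theorem2 = 4 , suc (tower 3 colours) , s≤s z≤n , s≤s z≤n
         , max-switching-cost-≥-agents 3 (subst (λ m → tower 3 m ℕ.< suc (tower 3 colours)) colours-def (n<1+n _))
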